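{- Let $\Sigma$ be a finite alphabet with $|\Sigma|>1$ and let $n\ge 1$ be an integer. Let $B=\{1,\ldots,n|\Sigma|^{n-1}\}$. Then there exists a $(1,2)$-sensitive bucketing function $f:\mathcal{S}_n\to\mathcal{P}(B)$ with $|f(s)|=n$ for every $s\in\mathcal{S}_n$. Moreover, for any finite set of buckets $B'$, no $(1,2)$-sensitive bucketing function $g:\mathcal{S}_n\to\mathcal{P}(B')$ exists if $|B'|<n|\Sigma|^{n-1}$, and no $(1,2)$-sensitive bucketing function $g$ exists with $|g(s)|<n$ for some $s\in\mathcal{S}_n$.
   Context: $\mathcal{S}_n$ denotes the set $\Sigma^n$ of all sequences of length $n$ over $\Sigma$, equipped with the edit (Levenshtein) distance $\mathrm{edit}(s,t)$, the minimum number of single-character insertions, deletions and substitutions transforming $s$ into $t$. Given a set $B$ of buckets, a bucketing function is a map $f:\mathcal{S}_n\to\mathcal{P}(B)$ (power set of $B$). For non-negative integers $d_1<d_2$, $f$ is $(d_1,d_2)$-sensitive if for all $s,t\in\mathcal{S}_n$: $\mathrm{edit}(s,t)\le d_1$ implies $f(s)\cap f(t)\ne\emptyset$, and $\mathrm{edit}(s,t)\ge d_2$ implies $f(s)\cap f(t)=\emptyset$. -}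

module Defs where

open import Data.Nat using (ℕ; zero; suc; _≤_)
open import Data.List using (List; []; _∷_; _++_)
open import Data.Vec using (Vec; toList)
open import Data.Fin using (Fin)
open import Data.Fin.Subset using (Subset; _∩_; Nonempty; Empty)
open import Data.Product using (Σ-syntax; _×_)

data Step {A : Set} : List A → List A → Set where
  ins : (xs ys : List A) (a : A) → Step (xs ++ ys) (xs ++ (a ∷ ys))
  del : (xs ys : List A) (a : A) → Step (xs ++ (a ∷ ys)) (xs ++ ys)
  sub : (xs ys : List A) (a b : A) → Step (xs ++ (a ∷ ys)) (xs ++ (b ∷ ys))

data Reach {A : Set} : ℕ → List A → List A → Set where
  done : (xs : List A) → Reach zero xs xs
  step : {j : ℕ} {xs ys zs : List A} → Step xs ys → Reach j ys zs → Reach (suc j) xs zs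

Seq : ℕ → ℕ → Set
Seq k n = Vec (Fin k) n

EditAtMost : {k n : ℕ} → ℕ → Seq k n → Seq k n → Set
EditAtMost d s t = Σ[ j ∈ ℕ ] (j ≤ d × Reach j (toList s) (toList t))

EditAtLeast : {k n : ℕ} → ℕ → Seq k n → Seq k n → Set
EditAtLeast d s t = ∀ j → Reach j (toList s) (toList t) → d ≤ j

-- (d₁,d₂)-sensitive bucketing function with bucket set B = Fin m,
-- P(B) represented by Subset m.
Sensitive : {k n m : ℕ} → ℕ → ℕ → (Seq k n → Subset m) → Set
Sensitive {k} {n} d₁ d₂ f =
  ((s t : Seq k n) → EditAtMost d₁ s t → Nonempty (f s ∩ f t)) ×
  ((s t : Seq k n) → EditAtLeast d₂ s t → Empty (f s ∩ f t))

{-# OPTIONS --safe #-}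
-- Two sequences of the same length are within edit distance 1 exactly when deleting one and the
-- same position from both leaves equal sequences; if they differ in two positions, their edit
-- distance is at least 2. So the buckets (i , w), for a position i and a word w of length n - 1,
-- with s in (i , w) iff deleting position i from s leaves w, form a (1,2)-sensitive function with
-- n buckets per sequence.
--
-- Conversely, in a (1,2)-sensitive g two sequences sharing a bucket agree off some position.
-- Changing one position of s in the n possible ways gives sequences pairwise differing in two
-- positions, so the buckets they share with s are distinct and |g s| ≥ n. For the line through
-- (i , w), i.e. the sequences obtained by inserting a letter into w at i, pick a bucket shared
-- by two of its points: a sequence near both of them lies on the line, so two lines sharing that
-- bucket coincide, and g uses at least n |Σ|^(n-1) buckets.
module Submission where

open import Defs
open import Data.Nat using (ℕ; zero; suc; _≤_; _<_; _*_; _^_; _∸_; _+_; z≤n; s≤s; _≤?_)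
open import Data.Nat.Properties using (1+n≢n; ≤-trans; <⇒≱; ≰⇒>; ≤-pred; *-identityʳ)
open import Data.Fin using (Fin; zero; suc; toℕ; punchIn; punchOut; combine; remQuot; funToFin; finToFun; _≟_)
open import Data.Fin.Properties using (toℕ-injective; suc-injective; punchInᵢ≢i; punchOut-punchIn; combine-remQuot; combine-surjective; funToFin-finToFin; finToFun-funToFin; injective⇒≤)
open import Data.Fin.Subset using (Subset; ∣_∣; _∈_; _∩_; ⁅_⁆; Nonempty; Empty; inside; outside)
open import Data.Fin.Subset.Properties using (x∈p∩q⁺; x∈p∩q⁻; x∈⁅x⁆; x∈⁅y⁆⇒x≡y; ∣⁅x⁆∣≡1)
open import Data.Vec as Vec using (Vec; []; _∷_; here; there; toList; lookup; removeAt; insertAt; tabulate; concat; _[_]≔_)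
open import Data.Vec.Properties using (toList-injective; length-toList; lookup∘tabulate; lookup-concat; removeAt-punchOut; removeAt-insertAt; insertAt-lookup; lookup∘update; lookup∘update′; []=⇒lookup; lookup⇒[]=)
open import Data.Vec.Relation.Binary.Equality.Cast using (cast-is-id)
open import Data.Vec.Relation.Binary.Pointwise.Extensional using (ext; Pointwise-≡⇒≡)
open import Data.List using (List; []; _∷_; _++_; length; take; drop)
open import Data.List.Properties using (∷-injectiveˡ; ∷-injectiveʳ; length-++-sucʳ)
open import Data.Product using (Σ-syntax; ∃; ∃₂; _×_; _,_; proj₁; proj₂; uncurry; map₂)
open import Data.Sum using (_⊎_; inj₁; inj₂)
open import Function using (_∘_)
open import Function.Definitions using (Injective)
open import Relation.Binary.Definitions using (DecidableEquality)
open import Relation.Binary.PropositionalEquality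
open import Relation.Nullary using (¬_; yes; no; contradiction)

private variable
  A : Set
  k m n c : ℕ

sameLength-step⇒substitution : {l₁ l₂ : List A} → Step l₁ l₂ → length l₁ ≡ length l₂ →
  Σ[ xs ∈ List A ] Σ[ ys ∈ List A ] Σ[ a ∈ A ] Σ[ b ∈ A ] (l₁ ≡ xs ++ a ∷ ys × l₂ ≡ xs ++ b ∷ ys)
sameLength-step⇒substitution (ins xs ys a) eq = contradiction (sym (trans eq (length-++-sucʳ xs a ys))) 1+n≢n
sameLength-step⇒substitution (del xs ys a) eq = contradiction (trans (sym (length-++-sucʳ xs a ys)) eq) 1+n≢n
sameLength-step⇒substitution (sub xs ys a b) _ = xs , ys , a , b , refl , refl

lookup-removeAt : (v : Vec A (suc n)) (i : Fin (suc n)) (j : Fin n) →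
  lookup (removeAt v i) j ≡ lookup v (punchIn i j)
lookup-removeAt v i j =
  trans (cong (lookup (removeAt v i)) (sym (punchOut-punchIn i))) (removeAt-punchOut v (punchInᵢ≢i i j ∘ sym))

toList-removeAt : (v : Vec A (suc n)) (i : Fin (suc n)) →
  toList v ≡ take (toℕ i) (toList (removeAt v i)) ++ lookup v i ∷ drop (toℕ i) (toList (removeAt v i))
toList-removeAt (x ∷ v) zero = refl
toList-removeAt (x ∷ y ∷ v) (suc i) = cong (x ∷_) (toList-removeAt (y ∷ v) i)

toList≡++∷⇒removeAt : (v : Vec A (suc n)) (xs : List A) (a : A) (ys : List A) → toList v ≡ xs ++ a ∷ ys →
  Σ[ i ∈ Fin (suc n) ] (toℕ i ≡ length xs × toList (removeAt v i) ≡ xs ++ ys)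
toList≡++∷⇒removeAt (x ∷ v) [] a ys eq = zero , refl , ∷-injectiveʳ eq
toList≡++∷⇒removeAt (x ∷ []) (_ ∷ []) a ys ()
toList≡++∷⇒removeAt (x ∷ []) (_ ∷ _ ∷ _) a ys ()
toList≡++∷⇒removeAt (x ∷ y ∷ v) (_ ∷ xs) a ys eq
  with i , i≡ , removed ← toList≡++∷⇒removeAt (y ∷ v) xs a ys (∷-injectiveʳ eq)
  = suc i , cong suc i≡ , cong₂ _∷_ (∷-injectiveˡ eq) removed

AgreeOff : Fin n → Vec A n → Vec A n → Set
AgreeOff i s t = ∀ j → j ≢ i → lookup s j ≡ lookup t j

DifferAt : Fin n → Vec A n → Vec A n → Set
DifferAt i s t = lookup s i ≢ lookup t i

Near : Vec A n → Vec A n → Set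
Near s t = ∃ λ i → AgreeOff i s t

DifferTwice : Vec A n → Vec A n → Set
DifferTwice s t = ∃₂ λ i j → i ≢ j × DifferAt i s t × DifferAt j s t

private variable
  i j : Fin n
  s t r : Vec A n

agreeOff-sym : AgreeOff i s t → AgreeOff i t s
agreeOff-sym st j j≢i = sym (st j j≢i)

agreeOff-trans : AgreeOff i s t → AgreeOff i t r → AgreeOff i s r
agreeOff-trans st tr j j≢i = trans (st j j≢i) (tr j j≢i)

agreeOff-differAt⇒≡ : AgreeOff i s t → DifferAt j s t → j ≡ i
agreeOff-differAt⇒≡ {i = i} {j = j} st d with j ≟ i
... | yes j≡i = j≡i
... | no j≢i = contradiction (st j j≢i) d

agreeOff⇒¬differTwice : AgreeOff i s t → ¬ DifferTwice s t
agreeOff⇒¬differTwice {s = s} {t = t} st (j , j′ , j≢j′ , d , d′) =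
  j≢j′ (trans (agreeOff-differAt⇒≡ {s = s} {t} st d) (sym (agreeOff-differAt⇒≡ {s = s} {t} st d′)))

-- If r agrees with s off some a ≠ i, then r agrees with s at i and hence differs from t there;
-- so r agrees with t off i, and therefore with s off i.
near-ends⇒agreeOff : AgreeOff i s t → DifferAt i s t → Near s r → Near t r → AgreeOff i s r
near-ends⇒agreeOff {i = i} {t = t} {r = r} st d (a , sr) (b , tr) j j≢i with a ≟ j
... | no a≢j = sr j (a≢j ∘ sym)
... | yes refl = trans (st j j≢i) (tr j (j≢i ∘ λ j≡b → trans j≡b (sym i≡b)))
  where
  i≡b : i ≡ b
  i≡b = agreeOff-differAt⇒≡ {s = t} {r} tr λ tᵢ≡rᵢ → d (trans (sr i (j≢i ∘ sym)) (sym tᵢ≡rᵢ))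

removeAt-≡⇒agreeOff : (s t : Vec A (suc n)) (i : Fin (suc n)) → removeAt s i ≡ removeAt t i → AgreeOff i s t
removeAt-≡⇒agreeOff s t i eq j j≢i =
  trans (sym (removeAt-punchOut s i≢j))
        (trans (cong (λ v → lookup v (punchOut i≢j)) eq) (removeAt-punchOut t i≢j))
  where
  i≢j : i ≢ j
  i≢j = j≢i ∘ sym

agreeOff⇒removeAt-≡ : (s t : Vec A (suc n)) (i : Fin (suc n)) → AgreeOff i s t → removeAt s i ≡ removeAt t i
agreeOff⇒removeAt-≡ s t i st = Pointwise-≡⇒≡ (ext λ j →
  trans (lookup-removeAt s i j) (trans (st (punchIn i j) (punchInᵢ≢i i j)) (sym (lookup-removeAt t i j))))

module _ (_≟ᴬ_ : DecidableEquality A) where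

  equal⊎differOnce⊎differTwice : (s t : Vec A n) →
    (∀ j → lookup s j ≡ lookup t j) ⊎ (∃ λ i → DifferAt i s t × AgreeOff i s t) ⊎ DifferTwice s t
  equal⊎differOnce⊎differTwice [] [] = inj₁ λ ()
  equal⊎differOnce⊎differTwice (x ∷ s) (y ∷ t) with equal⊎differOnce⊎differTwice s t | x ≟ᴬ y
  ... | inj₁ s≡t | yes refl = inj₁ λ { zero → refl ; (suc j) → s≡t j }
  ... | inj₁ s≡t | no x≢y =
    inj₂ (inj₁ (zero , x≢y , λ { zero 0≢0 → contradiction refl 0≢0 ; (suc j) _ → s≡t j }))
  ... | inj₂ (inj₁ (i , d , st)) | yes refl =
    inj₂ (inj₁ (suc i , d , λ { zero _ → refl ; (suc j) j≢i → st j (j≢i ∘ cong suc) }))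
  ... | inj₂ (inj₁ (i , d , _)) | no x≢y = inj₂ (inj₂ (zero , suc i , (λ ()) , x≢y , d))
  ... | inj₂ (inj₂ (i , j , i≢j , dᵢ , dⱼ)) | _ =
    inj₂ (inj₂ (suc i , suc j , i≢j ∘ suc-injective , dᵢ , dⱼ))

  near⊎differTwice : (s t : Vec A (suc n)) → Near s t ⊎ DifferTwice s t
  near⊎differTwice s t with equal⊎differOnce⊎differTwice s t
  ... | inj₁ s≡t = inj₁ (zero , λ j _ → s≡t j)
  ... | inj₂ (inj₁ (i , _ , st)) = inj₁ (i , st)
  ... | inj₂ (inj₂ twice) = inj₂ twice

toList-injective′ : (u w : Vec A n) → toList u ≡ toList w → u ≡ w
toList-injective′ u w eq = trans (sym (cast-is-id refl u)) (toList-injective refl u w eq)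

removeAt-≡⇒step : (s t : Vec A (suc n)) (i : Fin (suc n)) → removeAt s i ≡ removeAt t i →
  Step (toList s) (toList t)
removeAt-≡⇒step s t i eq rewrite toList-removeAt s i | toList-removeAt t i | eq =
  sub _ _ (lookup s i) (lookup t i)

step⇒removeAt-≡ : (s t : Vec A (suc n)) → Step (toList s) (toList t) → ∃ λ i → removeAt s i ≡ removeAt t i
step⇒removeAt-≡ s t st
  with xs , ys , a , b , s≡ , t≡ ←
         sameLength-step⇒substitution st (trans (length-toList s) (sym (length-toList t)))
  with i , i≡ , sᵢ ← toList≡++∷⇒removeAt s xs a ys s≡
     | i′ , i′≡ , tᵢ′ ← toList≡++∷⇒removeAt t xs b ys t≡
  with refl ← toℕ-injective (trans i≡ (sym i′≡))
  = i , toList-injective′ _ _ (trans sᵢ (sym tᵢ′))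

reach0⇒≡ : {l₁ l₂ : List A} → Reach 0 l₁ l₂ → l₁ ≡ l₂
reach0⇒≡ (done _) = refl

removeAt-≡⇒editAtMost1 : (s t : Seq k (suc n)) (i : Fin (suc n)) → removeAt s i ≡ removeAt t i →
  EditAtMost 1 s t
removeAt-≡⇒editAtMost1 s t i eq = 1 , s≤s z≤n , step (removeAt-≡⇒step s t i eq) (done _)

editAtMost1⇒removeAt-≡ : (s t : Seq k (suc n)) → EditAtMost 1 s t → ∃ λ i → removeAt s i ≡ removeAt t i
editAtMost1⇒removeAt-≡ s t (0 , _ , r) =
  zero , cong (λ v → removeAt v zero) (toList-injective′ s t (reach0⇒≡ r))
editAtMost1⇒removeAt-≡ s t (1 , _ , step st (done _)) = step⇒removeAt-≡ s t st
editAtMost1⇒removeAt-≡ s t (suc (suc _) , s≤s () , _)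

editAtLeast2⇒¬editAtMost1 : {s t : Seq k n} → EditAtLeast 2 s t → ¬ EditAtMost 1 s t
editAtLeast2⇒¬editAtMost1 atLeast (j , j≤1 , r) = contradiction (≤-trans (atLeast j r) j≤1) λ { (s≤s ()) }

agreeOff⇒editAtMost1 : (s t : Seq k (suc n)) (i : Fin (suc n)) → AgreeOff i s t → EditAtMost 1 s t
agreeOff⇒editAtMost1 s t i = removeAt-≡⇒editAtMost1 s t i ∘ agreeOff⇒removeAt-≡ s t i

differTwice⇒editAtLeast2 : (s t : Seq k (suc n)) → DifferTwice s t → EditAtLeast 2 s t
differTwice⇒editAtLeast2 s t twice j r with 2 ≤? j
... | yes 2≤j = 2≤j
... | no 2≰j with i , eq ← editAtMost1⇒removeAt-≡ s t (j , ≤-pred (≰⇒> 2≰j) , r) =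
  contradiction twice (agreeOff⇒¬differTwice {s = s} {t} (removeAt-≡⇒agreeOff s t i eq))

∣p++q∣ : (p : Subset m) (q : Subset n) → ∣ p Vec.++ q ∣ ≡ ∣ p ∣ + ∣ q ∣
∣p++q∣ [] q = refl
∣p++q∣ (inside ∷ p) q = cong suc (∣p++q∣ p q)
∣p++q∣ (outside ∷ p) q = ∣p++q∣ p q

∣concat∣ : (ps : Vec (Subset m) n) → (∀ i → ∣ lookup ps i ∣ ≡ c) → ∣ concat ps ∣ ≡ n * c
∣concat∣ [] _ = refl
∣concat∣ (p ∷ ps) ∣ps∣≡c =
  trans (∣p++q∣ p (concat ps)) (cong₂ _+_ (∣ps∣≡c zero) (∣concat∣ ps (∣ps∣≡c ∘ suc)))

rank : (p : Subset m) {x : Fin m} → x ∈ p → Fin ∣ p ∣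
rank (inside ∷ p) here = zero
rank (inside ∷ p) (there x∈p) = suc (rank p x∈p)
rank (outside ∷ p) (there x∈p) = rank p x∈p

rank-injective : (p : Subset m) {x y : Fin m} (x∈p : x ∈ p) (y∈p : y ∈ p) → rank p x∈p ≡ rank p y∈p → x ≡ y
rank-injective (inside ∷ p) here here _ = refl
rank-injective (inside ∷ p) (there x∈p) (there y∈p) eq =
  cong suc (rank-injective p x∈p y∈p (suc-injective eq))
rank-injective (outside ∷ p) (there x∈p) (there y∈p) eq = cong suc (rank-injective p x∈p y∈p eq)

injective-into⇒≤∣∣ : (p : Subset m) (h : Fin n → Fin m) → Injective _≡_ _≡_ h → (∀ i → h i ∈ p) →
  n ≤ ∣ p ∣
injective-into⇒≤∣∣ p h h-injective h∈p =
  injective⇒≤ λ {i} {j} eq → h-injective (rank-injective p (h∈p i) (h∈p j) eq)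

encode : Vec (Fin k) n → Fin (k ^ n)
encode v = funToFin (lookup v)

decode : Fin (k ^ n) → Vec (Fin k) n
decode x = tabulate (finToFun x)

encode-injective : Injective _≡_ _≡_ (encode {k} {n})
encode-injective {x = v} {w} eq = Pointwise-≡⇒≡ (ext λ j →
  trans (sym (finToFun-funToFin (lookup v) j))
        (trans (cong (λ x → finToFun x j) eq) (finToFun-funToFin (lookup w) j)))

funToFin-cong : {f g : Fin n → Fin k} → (∀ i → f i ≡ g i) → funToFin f ≡ funToFin g
funToFin-cong {zero} _ = refl
funToFin-cong {suc n} f≗g = cong₂ combine (f≗g zero) (funToFin-cong (f≗g ∘ suc))

encode-decode : ∀ {k n} (x : Fin (k ^ n)) → encode {k} {n} (decode x) ≡ x
encode-decode {k} {n} x =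
  trans (funToFin-cong {n} {k} (lookup∘tabulate (finToFun x))) (funToFin-finToFin {n} x)

decode-injective : ∀ {k n} → Injective _≡_ _≡_ (decode {k} {n})
decode-injective {k} {n} {x} {y} eq =
  trans (sym (encode-decode {k} {n} x)) (trans (cong encode eq) (encode-decode {k} {n} y))

remQuot-injective : ∀ {n} k → Injective _≡_ _≡_ (remQuot {n} k)
remQuot-injective {n} k {x} {y} eq =
  trans (sym (combine-remQuot {n} k x)) (trans (cong (uncurry combine) eq) (combine-remQuot {n} k y))

removalBucket : Seq k (suc n) → Fin (suc n) → Subset (k ^ n)
removalBucket s i = ⁅ encode (removeAt s i) ⁆

removalBuckets : Seq k (suc n) → Subset (suc n * k ^ n)
removalBuckets s = concat (tabulate (removalBucket s))

lookup-removalBuckets : (s : Seq k (suc n)) (i : Fin (suc n)) (x : Fin (k ^ n)) →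
  lookup (removalBuckets s) (combine i x) ≡ lookup (removalBucket s i) x
lookup-removalBuckets s i x =
  trans (lookup-concat (tabulate (removalBucket s)) i x)
        (cong (λ p → lookup p x) (lookup∘tabulate (removalBucket s) i))

removalBucket∈removalBuckets : (s : Seq k (suc n)) (i : Fin (suc n)) →
  combine i (encode (removeAt s i)) ∈ removalBuckets s
removalBucket∈removalBuckets s i =
  lookup⇒[]= _ (removalBuckets s)
    (trans (lookup-removalBuckets s i _) ([]=⇒lookup (x∈⁅x⁆ (encode (removeAt s i)))))

∈removalBuckets⇒≡ : (s : Seq k (suc n)) (i : Fin (suc n)) (x : Fin (k ^ n)) →
  combine i x ∈ removalBuckets s → x ≡ encode (removeAt s i)
∈removalBuckets⇒≡ s i x x∈ =
  x∈⁅y⁆⇒x≡y _ (lookup⇒[]= x (removalBucket s i) (trans (sym (lookup-removalBuckets s i x)) ([]=⇒lookup x∈)))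

removalBuckets-sensitive : ∀ {k n} → Sensitive 1 2 (removalBuckets {k} {n})
removalBuckets-sensitive {k} {n} = near⇒shared , far⇒disjoint
  where
  near⇒shared : (s t : Seq k (suc n)) → EditAtMost 1 s t → Nonempty (removalBuckets s ∩ removalBuckets t)
  near⇒shared s t atMost with i , eq ← editAtMost1⇒removeAt-≡ s t atMost =
    combine i (encode (removeAt s i)) ,
    x∈p∩q⁺ (removalBucket∈removalBuckets s i ,
      subst (λ v → combine i (encode v) ∈ removalBuckets t) (sym eq) (removalBucket∈removalBuckets t i))
  far⇒disjoint : (s t : Seq k (suc n)) → EditAtLeast 2 s t → Empty (removalBuckets s ∩ removalBuckets t)
  far⇒disjoint s t atLeast (b , b∈s∩t)
    with i , x , refl ← combine-surjective {suc n} {k ^ n} b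
    with b∈s , b∈t ← x∈p∩q⁻ (removalBuckets s) (removalBuckets t) b∈s∩t =
    editAtLeast2⇒¬editAtMost1 atLeast (removeAt-≡⇒editAtMost1 s t i (encode-injective
      (trans (sym (∈removalBuckets⇒≡ s i x b∈s)) (∈removalBuckets⇒≡ t i x b∈t))))

∣removalBuckets∣ : (s : Seq k (suc n)) → ∣ removalBuckets s ∣ ≡ suc n
∣removalBuckets∣ {n = n} s =
  trans (∣concat∣ (tabulate (removalBucket s)) λ i →
           trans (cong ∣_∣ (lookup∘tabulate (removalBucket s) i)) (∣⁅x⁆∣≡1 (encode (removeAt s i))))
        (*-identityʳ (suc n))

other : Fin (suc (suc k)) → Fin (suc (suc k))
other zero = suc zero
other (suc _) = zero

other≢ : (x : Fin (suc (suc k))) → other x ≢ x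
other≢ zero ()
other≢ (suc _) ()

module _ {k n m : ℕ} (g : Seq (suc (suc k)) (suc n) → Subset m) (g-sensitive : Sensitive 1 2 g) where

  commonBucket : (s t : Seq (suc (suc k)) (suc n)) (i : Fin (suc n)) → AgreeOff i s t →
    Σ[ b ∈ Fin m ] (b ∈ g s × b ∈ g t)
  commonBucket s t i st with b , b∈s∩t ← proj₁ g-sensitive s t (agreeOff⇒editAtMost1 s t i st) =
    b , x∈p∩q⁻ (g s) (g t) b∈s∩t

  sharedBucket⇒near : (s t : Seq (suc (suc k)) (suc n)) {b : Fin m} → b ∈ g s → b ∈ g t → Near s t
  sharedBucket⇒near s t b∈s b∈t with near⊎differTwice _≟_ s t
  ... | inj₁ near = near
  ... | inj₂ twice =
    contradiction (_ , x∈p∩q⁺ (b∈s , b∈t)) (proj₂ g-sensitive s t (differTwice⇒editAtLeast2 s t twice))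

  suc-n≤∣g∣ : (s : Seq (suc (suc k)) (suc n)) → suc n ≤ ∣ g s ∣
  suc-n≤∣g∣ s = injective-into⇒≤∣∣ (g s) bucket bucket-injective (proj₁ ∘ proj₂ ∘ shared)
    where
    change : Fin (suc n) → Seq (suc (suc k)) (suc n)
    change i = s [ i ]≔ other (lookup s i)

    change-agreeOff : ∀ i → AgreeOff i s (change i)
    change-agreeOff i j j≢i = sym (lookup∘update′ j≢i s _)

    change-differAt : ∀ {i j} → i ≢ j → DifferAt i (change i) (change j)
    change-differAt {i} {j} i≢j eq =
      other≢ (lookup s i) (trans (sym (lookup∘update i s _)) (trans eq (lookup∘update′ i≢j s _)))

    shared : ∀ i → Σ[ b ∈ Fin m ] (b ∈ g s × b ∈ g (change i))
    shared i = commonBucket s (change i) i (change-agreeOff i)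

    bucket : Fin (suc n) → Fin m
    bucket = proj₁ ∘ shared

    bucket-injective : Injective _≡_ _≡_ bucket
    bucket-injective {i} {j} eq with i ≟ j
    ... | yes i≡j = i≡j
    ... | no i≢j
      with c , agree ← sharedBucket⇒near (change i) (change j) (proj₂ (proj₂ (shared i)))
                         (subst (_∈ g (change j)) (sym eq) (proj₂ (proj₂ (shared j)))) =
      contradiction (i , j , i≢j , change-differAt i≢j , (change-differAt (i≢j ∘ sym) ∘ sym))
        (agreeOff⇒¬differTwice {s = change i} {change j} agree)

  line : Fin (suc n) → Vec (Fin (suc (suc k))) n → Fin (suc (suc k)) → Seq (suc (suc k)) (suc n)
  line i u a = insertAt u i a

  line-agreeOff : (i : Fin (suc n)) (u : Vec (Fin (suc (suc k))) n) (a b : Fin (suc (suc k))) →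
    AgreeOff i (line i u a) (line i u b)
  line-agreeOff i u a b = removeAt-≡⇒agreeOff (line i u a) (line i u b) i
    (trans (removeAt-insertAt u i a) (sym (removeAt-insertAt u i b)))

  line-differAt : (i : Fin (suc n)) (u : Vec (Fin (suc (suc k))) n) →
    DifferAt i (line i u zero) (line i u (suc zero))
  line-differAt i u eq
    with () ← trans (sym (insertAt-lookup u i zero)) (trans eq (insertAt-lookup u i (suc zero)))

  lineShared : (i : Fin (suc n)) (u : Vec (Fin (suc (suc k))) n) →
    Σ[ b ∈ Fin m ] (b ∈ g (line i u zero) × b ∈ g (line i u (suc zero)))
  lineShared i u = commonBucket (line i u zero) (line i u (suc zero)) i (line-agreeOff i u zero (suc zero))

  lineBucket : Fin (suc n) → Vec (Fin (suc (suc k))) n → Fin m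
  lineBucket i u = proj₁ (lineShared i u)

  lineBucket-injective : ∀ {i i′ u u′} → lineBucket i u ≡ lineBucket i′ u′ → i ≡ i′ × u ≡ u′
  lineBucket-injective {i} {i′} {u} {u′} eq = i≡i′ , u≡u′
    where
    p₀ p₁ q₀ q₁ : Seq (suc (suc k)) (suc n)
    p₀ = line i u zero
    p₁ = line i u (suc zero)
    q₀ = line i′ u′ zero
    q₁ = line i′ u′ (suc zero)

    b : Fin m
    b = lineBucket i u

    b∈p₀ : b ∈ g p₀
    b∈p₀ = proj₁ (proj₂ (lineShared i u))
    b∈p₁ : b ∈ g p₁
    b∈p₁ = proj₂ (proj₂ (lineShared i u))
    b∈q₀ : b ∈ g q₀
    b∈q₀ = subst (_∈ g q₀) (sym eq) (proj₁ (proj₂ (lineShared i′ u′)))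
    b∈q₁ : b ∈ g q₁
    b∈q₁ = subst (_∈ g q₁) (sym eq) (proj₂ (proj₂ (lineShared i′ u′)))

    onLine : ∀ r → b ∈ g r → AgreeOff i p₀ r
    onLine r b∈r =
      near-ends⇒agreeOff {s = p₀} {p₁} {r} (line-agreeOff i u zero (suc zero)) (line-differAt i u)
      (sharedBucket⇒near p₀ r b∈p₀ b∈r) (sharedBucket⇒near p₁ r b∈p₁ b∈r)

    q₀-onLine : AgreeOff i p₀ q₀
    q₀-onLine = onLine q₀ b∈q₀

    i≡i′ : i ≡ i′
    i≡i′ = sym (agreeOff-differAt⇒≡ {s = q₀} {q₁}
      (agreeOff-trans {s = q₀} {p₀} {q₁} (agreeOff-sym {s = p₀} {q₀} q₀-onLine) (onLine q₁ b∈q₁))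
      (line-differAt i′ u′))

    u≡u′ : u ≡ u′
    u≡u′ = begin
      u               ≡⟨ removeAt-insertAt u i zero ⟨
      removeAt p₀ i   ≡⟨ agreeOff⇒removeAt-≡ p₀ q₀ i q₀-onLine ⟩
      removeAt q₀ i   ≡⟨ cong (removeAt q₀) i≡i′ ⟩
      removeAt q₀ i′  ≡⟨ removeAt-insertAt u′ i′ zero ⟩
      u′              ∎
      where open ≡-Reasoning

  lines≤buckets : suc n * suc (suc k) ^ n ≤ m
  lines≤buckets = injective⇒≤ {f = uncurry lineBucket ∘ slot} λ eq →
    let i≡i′ , u≡u′ = lineBucket-injective eq in
    remQuot-injective (suc (suc k) ^ n) (cong₂ _,_ i≡i′ (decode-injective u≡u′))
    where
    slot : Fin (suc n * suc (suc k) ^ n) → Fin (suc n) × Vec (Fin (suc (suc k))) n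
    slot = map₂ decode ∘ remQuot (suc (suc k) ^ n)

theorem1 : (k n : ℕ) → 2 ≤ k → 1 ≤ n →
    (Σ[ f ∈ (Seq k n → Subset (n * k ^ (n ∸ 1))) ]
        (Sensitive 1 2 f × ((s : Seq k n) → ∣ f s ∣ ≡ n)))
    × ((m : ℕ) → m < n * k ^ (n ∸ 1) → (g : Seq k n → Subset m) → ¬ Sensitive 1 2 g)
    × ((m : ℕ) (g : Seq k n → Subset m) → Sensitive 1 2 g → (s : Seq k n) → n ≤ ∣ g s ∣)
theorem1 (suc (suc k)) (suc n) (s≤s (s≤s z≤n)) (s≤s z≤n) =
  (removalBuckets , removalBuckets-sensitive , ∣removalBuckets∣) ,
  (λ _ m<count g g-sensitive → <⇒≱ m<count (lines≤buckets g g-sensitive)) ,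
  (λ _ → suc-n≤∣g∣)
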